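{- Let $m\ge2$, let $s\ge1$ be an integer with $s \leq m/2$, let $n \geq 1$ and $\ell\ge0$. Let $\mathcal{F}$ be a family on $\mathbb{Z}_m^n \times \{0,1\}^\ell$ which is $t$-agreeing up to $s$. Then there is a family $\mathcal{H}$ on $\mathbb{Z}_m^{n-1} \times \{0,1\}^{\ell+1}$ which is $t$-agreeing up to $s$ and satisfies $\mu_{s,m}^{n-1,\ell+1}(\mathcal{H}) \geq \mu_{s,m}^{n,\ell}(\mathcal{F})$.
   Context: A family on $\mathbb{Z}_m^n \times \{0,1\}^\ell$ is a subset of it. Two vectors $x,y\in\mathbb{Z}_m^n \times \{0,1\}^\ell$ $s$-agree on a coordinate $i\le n$ if $x_i-y_i\in\{ -(s-1),\dots,s-1\}$ (in $\mathbb{Z}_m$), and on a coordinate $i>n$ if $x_i=y_i=1$. A family is $t$-agreeing up to $s$ if every two of its vectors (including a vector with itself) $s$-agree on at least $t$ coordinates. The measure $\mu_{s,m}^{n,\ell}=\mu_m^n\times\mu_{s/m}^\ell$ is the product of the uniform probability measure on each $\mathbb{Z}_m$ coordinate and, on each $\{0,1\}$ coordinate, the measure giving $1$ probability $s/m$ and $0$ probability $1-s/m$. -}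

module Defs where

open import Data.Nat as ℕ using (ℕ; zero; suc; _≤_; _<_; NonZero)
open import Data.Integer as ℤ using (ℤ; +_)
open import Data.Integer.Divisibility using () renaming (_∣_ to _∣ℤ_)
open import Data.Rational as ℚ using (ℚ; 0ℚ; 1ℚ)
open import Data.Fin using (Fin; toℕ)
open import Data.Fin.Subset using (Subset; _∈_; ∣_∣)
open import Data.Vec using (Vec; []; _∷_; lookup)
open import Data.List using (List; []; _∷_; map; concatMap; foldr; _++_)
open import Data.Bool using (Bool; true; false; if_then_else_)
open import Data.Product using (Σ; _×_; ∃-syntax)
open import Relation.Binary.PropositionalEquality using (_≡_)

-- Points of ℤ_m^n × {0,1}^ℓ : a vector of residues (Fin m) and a vector of bits.
-- A family is (the characteristic function of) a subset of that finite set.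
Family : (m n ℓ : ℕ) → Set
Family m n ℓ = Vec (Fin m) n → Vec Bool ℓ → Bool

AgreeZ : (m s : ℕ) → Fin m → Fin m → Set
AgreeZ m s a b = ∃[ k ] ((ℤ.∣ k ∣ < s) × ((+ m) ∣ℤ ((+ toℕ a ℤ.- + toℕ b) ℤ.- k)))

AgreeB : Bool → Bool → Set
AgreeB a b = (a ≡ true) × (b ≡ true)

AgreeOnAtLeast : (m s t : ℕ) {n ℓ : ℕ} →
  (Vec (Fin m) n × Vec Bool ℓ) → (Vec (Fin m) n × Vec Bool ℓ) → Set
AgreeOnAtLeast m s t {n} {ℓ} (x₁ Data.Product., y₁) (x₂ Data.Product., y₂) =
  Σ (Subset n) λ S₁ → Σ (Subset ℓ) λ S₂ →
    (t ≤ ∣ S₁ ∣ ℕ.+ ∣ S₂ ∣) ×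
    (∀ i → i ∈ S₁ → AgreeZ m s (lookup x₁ i) (lookup x₂ i)) ×
    (∀ j → j ∈ S₂ → AgreeB (lookup y₁ j) (lookup y₂ j))

-- F is t-agreeing up to s (pairs include a vector with itself)
TAgreeing : (m s t : ℕ) {n ℓ : ℕ} → Family m n ℓ → Set
TAgreeing m s t {n} {ℓ} F =
  ∀ x₁ y₁ x₂ y₂ → F x₁ y₁ ≡ true → F x₂ y₂ ≡ true →
    AgreeOnAtLeast m s t (x₁ Data.Product., y₁) (x₂ Data.Product., y₂)

allFinVecs : (m n : ℕ) → List (Vec (Fin m) n)
allFinVecs m zero = [] ∷ []
allFinVecs m (suc n) =
  concatMap (λ a → map (a ∷_) (allFinVecs m n)) (Data.List.allFin m)

allBoolVecs : (ℓ : ℕ) → List (Vec Bool ℓ)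
allBoolVecs zero = [] ∷ []
allBoolVecs (suc ℓ) = map (true ∷_) (allBoolVecs ℓ) ++ map (false ∷_) (allBoolVecs ℓ)

sumℚ : List ℚ → ℚ
sumℚ = foldr ℚ._+_ 0ℚ

weightZ : (m : ℕ) .{{_ : NonZero m}} {n : ℕ} → Vec (Fin m) n → ℚ
weightZ m [] = 1ℚ
weightZ m (_ ∷ x) = (+ 1 ℚ./ m) ℚ.* weightZ m x

weightB : (m s : ℕ) .{{_ : NonZero m}} {ℓ : ℕ} → Vec Bool ℓ → ℚ
weightB m s [] = 1ℚ
weightB m s (true ∷ y) = (+ s ℚ./ m) ℚ.* weightB m s y
weightB m s (false ∷ y) = (1ℚ ℚ.- (+ s ℚ./ m)) ℚ.* weightB m s y

μ : (s m n ℓ : ℕ) .{{_ : NonZero m}} → Family m n ℓ → ℚ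
μ s m n ℓ F =
  sumℚ (concatMap (λ x → map (λ y →
    if F x y then weightZ m x ℚ.* weightB m s y else 0ℚ) (allBoolVecs ℓ)) (allFinVecs m n))

module Submission where

-- For p = (x, y) let A_p = {a ∣ (a ∷ x, y) ∈ F} be its fibre.  For a threshold
-- θ ≥ s, the family H θ contains (x, 0 ∷ y) when |A_p| > θ, and (x, 1 ∷ y) when
-- A_p ≠ ∅ and no q with |A_q| > θ is compatible with p (no a ∈ A_p, b ∈ A_q
-- with a - b ∈ {s, …, m - s}).  Incompatible fibres contain two residues that
-- do not s-agree, so the members of F above them agree elsewhere; compatible
-- fibres satisfy |A_p| + |A_q| ≤ 2s by a Cauchy–Davenport bound for sums with
-- an interval in ℤ_m.  Hence every H θ is t-agreeing.  A counting argument
-- shows that the s thresholds θ = s, …, 2s - 1 together have at least s times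
-- the measure of F, so one of them does at least as well as F.

open import Defs
open import Data.Nat using (ℕ; suc; _≤_; _*_; NonZero)
open import Data.Rational using () renaming (_≤_ to _≤ℚ_)
open import Data.Product using (Σ; _×_)

open import Data.Nat as ℕ using (zero; _+_; _∸_; _<_; _⊓_; z≤n; s≤s; _%_; _/_)
import Data.Nat.Properties as ℕP
open import Data.Nat.DivMod using (m≡m%n+[m/n]*n; m%n<n; m<n⇒m%n≡m; [m+n]%n≡m%n; [m+kn]%n≡m%n)
open import Data.Nat.Divisibility using (∣⇒≤) renaming (_∣_ to _∣ℕ_)
import Data.Nat.Tactic.RingSolver as ℕSolver
open import Data.Integer as ℤ using (ℤ; +_; -[1+_])
import Data.Integer.Properties as ℤP
import Data.Integer.Divisibility.Signed as ℤDiv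
import Data.Integer.Tactic.RingSolver as ℤSolver
open import Data.Rational as ℚ using (ℚ; 0ℚ; 1ℚ; toℚᵘ)
import Data.Rational.Properties as ℚP
open import Data.Rational.Solver using (module +-*-Solver)
open import Data.Rational.Unnormalised as ℚᵘ using (ℚᵘ; mkℚᵘ; *≡*; *≤*) renaming (_≃_ to _≃ᵘ_)
import Data.Rational.Unnormalised.Properties as ℚᵘP
open import Data.Fin as Fin using (Fin; toℕ; fromℕ<)
import Data.Fin.Properties as FinP
open import Data.Fin.Subset using (_∈_; ∣_∣)
open import Data.Vec using (Vec; []; _∷_; lookup; here; there)
open import Data.Bool using (Bool; true; false; if_then_else_; _∨_)
import Data.Bool.Properties as BoolP
open import Data.List as List using (List; []; _∷_; map; concatMap; _++_; allFin; downFrom)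
import Data.List.Properties as ListP
open import Data.List.Membership.Propositional.Properties using (∈-allFin; ∈-map⁺; ∈-++⁺ˡ; ∈-++⁺ʳ; ∈-concatMap⁺)
open import Data.List.Relation.Unary.Any as Any using (Any)
open import Data.List.Membership.Propositional using () renaming (_∈_ to _∈ₗ_)
open import Data.Product using (_,_; ∃; ∃-syntax; proj₁; proj₂)
open import Data.Sum using (_⊎_; inj₁; inj₂)
open import Data.Empty using (⊥)
open import Relation.Nullary using (¬_; Dec; yes; no; does; ¬?; _×-dec_; contradiction)
open import Relation.Nullary.Decidable using (dec-true)
open import Relation.Binary.PropositionalEquality hiding (J)

-- Identities
-- between rationals with small denominators are proved by passing to
-- unnormalised rationals, where they become identities between integers.

ι : ℕ → ℚ
ι k = + k ℚ./ 1

toℚᵘ-/ : ∀ (i : ℤ) d → toℚᵘ (i ℚ./ suc d) ≃ᵘ mkℚᵘ i d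
toℚᵘ-/ i d = ℚP.toℚᵘ-fromℚᵘ (mkℚᵘ i d)

viaℚᵘ : ∀ {p q : ℚ} {u v : ℚᵘ} → toℚᵘ p ≃ᵘ u → u ≃ᵘ v → toℚᵘ q ≃ᵘ v → p ≡ q
viaℚᵘ p≃u u≃v q≃v = ℚP.toℚᵘ-injective (ℚᵘP.≃-trans p≃u (ℚᵘP.≃-trans u≃v (ℚᵘP.≃-sym q≃v)))

ι-+ : ∀ a b → ι (a + b) ≡ ι a ℚ.+ ι b
ι-+ a b = viaℚᵘ (toℚᵘ-/ (+ (a + b)) 0)
  (*≡* (trans (cong (ℤ._* + 1) (ℤP.pos-+ a b)) (identity (+ a) (+ b))))
  (ℚᵘP.≃-trans (ℚP.toℚᵘ-homo-+ (ι a) (ι b)) (ℚᵘP.+-cong (toℚᵘ-/ (+ a) 0) (toℚᵘ-/ (+ b) 0)))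
  where
  open ℤSolver
  identity : ∀ (x y : ℤ) → (x ℤ.+ y) ℤ.* + 1 ≡ (x ℤ.* + 1 ℤ.+ y ℤ.* + 1) ℤ.* + 1
  identity = solve-∀

ι-* : ∀ a b → ι (a * b) ≡ ι a ℚ.* ι b
ι-* a b = viaℚᵘ (toℚᵘ-/ (+ (a * b)) 0)
  (*≡* (cong (ℤ._* + 1) (ℤP.pos-* a b)))
  (ℚᵘP.≃-trans (ℚP.toℚᵘ-homo-* (ι a) (ι b)) (ℚᵘP.*-cong (toℚᵘ-/ (+ a) 0) (toℚᵘ-/ (+ b) 0)))

ι-mono : ∀ {a b} → a ≤ b → ι a ℚ.≤ ι b
ι-mono {a} {b} a≤b = ℚP.toℚᵘ-cancel-≤
  (ℚᵘP.≤-respˡ-≃ (ℚᵘP.≃-sym (toℚᵘ-/ (+ a) 0)) (ℚᵘP.≤-respʳ-≃ (ℚᵘP.≃-sym (toℚᵘ-/ (+ b) 0))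
    (*≤* (subst₂ ℤ._≤_ (sym (ℤP.*-identityʳ (+ a))) (sym (ℤP.*-identityʳ (+ b))) (ℤ.+≤+ a≤b)))))

ι-nonNeg : ∀ k → 0ℚ ℚ.≤ ι k
ι-nonNeg k = ι-mono {0} {k} z≤n

*-nonNeg : ∀ {a b} → 0ℚ ℚ.≤ a → 0ℚ ℚ.≤ b → 0ℚ ℚ.≤ a ℚ.* b
*-nonNeg {a} {b} 0≤a 0≤b = ℚP.nonNegative⁻¹ (a ℚ.* b)
  {{ℚP.nonNeg*nonNeg⇒nonNeg a {{ℚ.nonNegative 0≤a}} b {{ℚ.nonNegative 0≤b}}}}

module UnitFraction (M : ℕ) where

  unit : ℚ
  unit = + 1 ℚ./ suc M

  unit-nonNeg : 0ℚ ℚ.≤ unit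
  unit-nonNeg = ℚP.toℚᵘ-cancel-≤ (ℚᵘP.≤-respʳ-≃ (ℚᵘP.≃-sym (toℚᵘ-/ (+ 1) M)) (*≤* (ℤ.+≤+ z≤n)))

  fraction : ∀ k → + k ℚ./ suc M ≡ ι k ℚ.* unit
  fraction k = viaℚᵘ (toℚᵘ-/ (+ k) M)
    (*≡* (trans (cong (λ d → + k ℤ.* + suc d) (ℕP.+-identityʳ M)) (identity (+ k) (+ suc M))))
    (ℚᵘP.≃-trans (ℚP.toℚᵘ-homo-* (ι k) unit) (ℚᵘP.*-cong (toℚᵘ-/ (+ k) 0) (toℚᵘ-/ (+ 1) M)))
    where
    open ℤSolver
    identity : ∀ (x y : ℤ) → x ℤ.* y ≡ (x ℤ.* + 1) ℤ.* y
    identity = solve-∀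

  fraction-whole : ι (suc M) ℚ.* unit ≡ 1ℚ
  fraction-whole = trans (sym (fraction (suc M)))
    (viaℚᵘ (toℚᵘ-/ (+ suc M) M) (*≡* (ℤP.*-comm (+ suc M) (+ 1))) (toℚᵘ-/ (+ 1) 0))

bit : Bool → ℕ
bit b = if b then 1 else 0

ΣL : {A : Set} → List A → (A → ℚ) → ℚ
ΣL xs f = sumℚ (map f xs)

count : {A : Set} → (A → Bool) → List A → ℕ
count P [] = 0
count P (x ∷ xs) = bit (P x) + count P xs

sumℚ-++ : (xs ys : List ℚ) → sumℚ (xs ++ ys) ≡ sumℚ xs ℚ.+ sumℚ ys
sumℚ-++ [] ys = sym (ℚP.+-identityˡ _)
sumℚ-++ (x ∷ xs) ys = trans (cong (x ℚ.+_) (sumℚ-++ xs ys)) (sym (ℚP.+-assoc x _ _))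

module _ {A : Set} where

  ΣL-cong : (xs : List A) {f g : A → ℚ} → (∀ x → f x ≡ g x) → ΣL xs f ≡ ΣL xs g
  ΣL-cong [] f≗g = refl
  ΣL-cong (x ∷ xs) f≗g = cong₂ ℚ._+_ (f≗g x) (ΣL-cong xs f≗g)

  ΣL-mono : (xs : List A) {f g : A → ℚ} → (∀ x → f x ℚ.≤ g x) → ΣL xs f ℚ.≤ ΣL xs g
  ΣL-mono [] f≤g = ℚP.≤-refl
  ΣL-mono (x ∷ xs) f≤g = ℚP.+-mono-≤ (f≤g x) (ΣL-mono xs f≤g)

  ΣL-+ : (xs : List A) (f g : A → ℚ) → ΣL xs (λ x → f x ℚ.+ g x) ≡ ΣL xs f ℚ.+ ΣL xs g
  ΣL-+ [] f g = refl
  ΣL-+ (x ∷ xs) f g = trans (cong (f x ℚ.+ g x ℚ.+_) (ΣL-+ xs f g))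
    (solve 4 (λ a b c d → (a :+ b) :+ (c :+ d) := (a :+ c) :+ (b :+ d)) refl (f x) (g x) (ΣL xs f) (ΣL xs g))
    where open +-*-Solver

  ΣL-scale : (xs : List A) (c : ℚ) (f : A → ℚ) → ΣL xs (λ x → c ℚ.* f x) ≡ c ℚ.* ΣL xs f
  ΣL-scale [] c f = sym (ℚP.*-zeroʳ c)
  ΣL-scale (x ∷ xs) c f = trans (cong (c ℚ.* f x ℚ.+_) (ΣL-scale xs c f)) (sym (ℚP.*-distribˡ-+ c (f x) (ΣL xs f)))

  ΣL-zero : (xs : List A) → ΣL xs (λ _ → 0ℚ) ≡ 0ℚ
  ΣL-zero [] = refl
  ΣL-zero (x ∷ xs) = trans (ℚP.+-identityˡ _) (ΣL-zero xs)

  ΣL-++ : (xs ys : List A) (f : A → ℚ) → ΣL (xs ++ ys) f ≡ ΣL xs f ℚ.+ ΣL ys f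
  ΣL-++ xs ys f = trans (cong sumℚ (ListP.map-++ f xs ys)) (sumℚ-++ (map f xs) (map f ys))

  sumℚ-concatMap : (xs : List A) (g : A → List ℚ) → sumℚ (concatMap g xs) ≡ ΣL xs (λ x → sumℚ (g x))
  sumℚ-concatMap [] g = refl
  sumℚ-concatMap (x ∷ xs) g = trans (sumℚ-++ (g x) (concatMap g xs)) (cong (sumℚ (g x) ℚ.+_) (sumℚ-concatMap xs g))

  ΣL-indicator : (xs : List A) (P : A → Bool) (c : ℚ) →
    ΣL xs (λ x → if P x then c else 0ℚ) ≡ ι (count P xs) ℚ.* c
  ΣL-indicator [] P c = sym (ℚP.*-zeroˡ c)
  ΣL-indicator (x ∷ xs) P c with P x
  ... | false = trans (ℚP.+-identityˡ _) (ΣL-indicator xs P c)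
  ... | true = begin
    c ℚ.+ ΣL xs (λ x → if P x then c else 0ℚ) ≡⟨ cong (c ℚ.+_) (ΣL-indicator xs P c) ⟩
    c ℚ.+ ι (count P xs) ℚ.* c                ≡⟨ solve 2 (λ c k → c :+ k :* c := (con 1ℚ :+ k) :* c) refl c (ι (count P xs)) ⟩
    (1ℚ ℚ.+ ι (count P xs)) ℚ.* c             ≡⟨ cong (ℚ._* c) (sym (ι-+ 1 (count P xs))) ⟩
    ι (suc (count P xs)) ℚ.* c                ∎
    where open ≡-Reasoning; open +-*-Solver

module _ {A B : Set} where

  ΣL-map : (xs : List A) (g : A → B) (f : B → ℚ) → ΣL (map g xs) f ≡ ΣL xs (λ x → f (g x))
  ΣL-map xs g f = cong sumℚ (sym (ListP.map-∘ xs))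

  ΣL-concatMap : (xs : List A) (g : A → List B) (f : B → ℚ) → ΣL (concatMap g xs) f ≡ ΣL xs (λ x → ΣL (g x) f)
  ΣL-concatMap xs g f = trans (cong sumℚ (ListP.map-concatMap f g xs)) (sumℚ-concatMap xs (λ x → map f (g x)))

  ΣL-swap : (xs : List A) (ys : List B) (f : A → B → ℚ) →
    ΣL xs (λ a → ΣL ys (f a)) ≡ ΣL ys (λ b → ΣL xs (λ a → f a b))
  ΣL-swap [] ys f = sym (ΣL-zero ys)
  ΣL-swap (x ∷ xs) ys f = trans (cong (ΣL ys (f x) ℚ.+_) (ΣL-swap xs ys f)) (sym (ΣL-+ ys (f x) _))

count-witness : ∀ {A : Set} (P : A → Bool) xs → 1 ≤ count P xs → ∃ λ x → P x ≡ true
count-witness P (x ∷ xs) pos with P x in Px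
... | true = x , Px
... | false = count-witness P xs pos

count-interval : ∀ n a b (P : ℕ → Bool) → b ≤ n → (∀ u → a ≤ u → u < b → P u ≡ true) →
  b ∸ a ≤ count P (downFrom n)
count-interval zero a zero P _ _ = ℕP.≤-reflexive (ℕP.0∸n≡0 a)
count-interval (suc n) a b P b≤1+n holds with b ℕP.≤? n
... | yes b≤n = ℕP.≤-trans (count-interval n a b P b≤n holds) (ℕP.m≤n+m _ (bit (P n)))
... | no b≰n with ℕP.≤-antisym b≤1+n (ℕP.≰⇒> b≰n) | a ℕP.≤? n
...   | refl | no a≰n = ℕP.≤-trans (ℕP.≤-reflexive (ℕP.m≤n⇒m∸n≡0 (ℕP.≰⇒> a≰n))) z≤n
...   | refl | yes a≤n rewrite holds n a≤n ℕP.≤-refl | ℕP.+-∸-assoc 1 a≤n =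
  s≤s (count-interval n a n P ℕP.≤-refl (λ u a≤u u<n → holds u a≤u (ℕP.m≤n⇒m≤1+n u<n)))

average : ∀ k (f : ℕ → ℚ) c → ι (suc k) ℚ.* c ℚ.≤ ΣL (downFrom (suc k)) f → ∃ λ u → c ℚ.≤ f u
average zero f c 1c≤f0 = 0 , subst₂ ℚ._≤_ (ℚP.*-identityˡ c) (ℚP.+-identityʳ (f 0)) 1c≤f0
average (suc k) f c bound with c ℚP.≤? f (suc k)
... | yes c≤f = suc k , c≤f
... | no c≰f = average k f c (ℚP.≮⇒≥ rest-too-small)
  where
  split : ι (suc (suc k)) ℚ.* c ≡ c ℚ.+ ι (suc k) ℚ.* c
  split = trans (cong (ℚ._* c) (ι-+ 1 (suc k)))
    (trans (ℚP.*-distribʳ-+ c 1ℚ (ι (suc k))) (cong (ℚ._+ ι (suc k) ℚ.* c) (ℚP.*-identityˡ c)))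
  rest-too-small : ¬ (ΣL (downFrom (suc k)) f ℚ.< ι (suc k) ℚ.* c)
  rest-too-small rest<avg = ℚP.<-irrefl refl
    (ℚP.<-≤-trans (ℚP.+-mono-< (ℚP.≰⇒> c≰f) rest<avg) (subst (ℚ._≤ _) split bound))

*-≤-⊓ : ∀ a s d → a ≤ d → s ≤ d → a * s ≤ (a ⊓ s) * d
*-≤-⊓ a s d a≤d s≤d with ℕP.≤-total a s
... | inj₁ a≤s rewrite ℕP.m≤n⇒m⊓n≡m a≤s = ℕP.*-monoʳ-≤ a s≤d
... | inj₂ s≤a rewrite ℕP.m≥n⇒m⊓n≡n s≤a | ℕP.*-comm a s = ℕP.*-monoʳ-≤ s a≤d

-- The arithmetic behind the averaging over the thresholds θ = s + u, u < s, for a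
-- fibre of size k: if (x, 1 ∷ y) survives for all u with s ≤ k + u (Q) and
-- (x, 0 ∷ y) is present for all u with s + u < k (P), then the s thresholds
-- together gain at least s·k, counted in units of 1/m.
threshold-inequality : ∀ s k m (Q P : ℕ → Bool) → k ≤ m → s + s ≤ m →
  (1 ≤ k → ∀ u → u < s → s ≤ k + u → Q u ≡ true) → (∀ u → s + u < k → P u ≡ true) →
  s * k ≤ count Q (downFrom s) * s + count P (downFrom s) * (m ∸ s)
threshold-inequality s zero m Q P _ _ _ _ = ℕP.≤-trans (ℕP.≤-reflexive (ℕP.*-zeroʳ s)) z≤n
threshold-inequality s k@(suc _) m Q P k≤m 2s≤m survives present with k ℕP.≤? s
... | yes k≤s = begin
  s * k                                    ≡⟨ ℕP.*-comm s k ⟩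
  k * s                                    ≡⟨ cong (_* s) (sym (ℕP.m∸[m∸n]≡n k≤s)) ⟩
  (s ∸ (s ∸ k)) * s                        ≤⟨ ℕP.*-monoˡ-≤ s (count-interval s (s ∸ k) s Q ℕP.≤-refl
                                                (λ u s-k≤u u<s → survives (s≤s z≤n) u u<s (s≤k+u u s-k≤u))) ⟩
  count Q (downFrom s) * s                 ≤⟨ ℕP.m≤m+n _ _ ⟩
  count Q (downFrom s) * s + count P (downFrom s) * (m ∸ s) ∎
  where
  open ℕP.≤-Reasoning
  s≤k+u : ∀ u → s ∸ k ≤ u → s ≤ k + u
  s≤k+u u s-k≤u = ℕP.≤-trans (ℕP.m≤n+m∸n s k) (ℕP.+-monoʳ-≤ k s-k≤u)
... | no k≰s = begin
  s * k                                    ≡⟨ cong (s *_) (sym s+e≡k) ⟩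
  s * (s + e)                              ≡⟨ distribute s e ⟩
  s * s + e * s                            ≤⟨ ℕP.+-monoʳ-≤ (s * s) (*-≤-⊓ e s (m ∸ s) (ℕP.∸-monoˡ-≤ s k≤m) s≤m-s) ⟩
  s * s + (e ⊓ s) * (m ∸ s)                ≤⟨ ℕP.+-mono-≤ (ℕP.*-monoˡ-≤ s all-survive) (ℕP.*-monoˡ-≤ (m ∸ s) enough-present) ⟩
  count Q (downFrom s) * s + count P (downFrom s) * (m ∸ s) ∎
  where
  open ℕP.≤-Reasoning
  s<k = ℕP.≰⇒> k≰s
  e = k ∸ s
  s+e≡k : s + e ≡ k
  s+e≡k = ℕP.m+[n∸m]≡n (ℕP.<⇒≤ s<k)
  distribute : ∀ s e → s * (s + e) ≡ s * s + e * s
  distribute = ℕSolver.solve-∀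
  s≤m-s : s ≤ m ∸ s
  s≤m-s = ℕP.≤-trans (ℕP.≤-reflexive (sym (ℕP.m+n∸n≡m s s))) (ℕP.∸-monoˡ-≤ s 2s≤m)
  all-survive : s ≤ count Q (downFrom s)
  all-survive = count-interval s 0 s Q ℕP.≤-refl
    (λ u _ u<s → survives (s≤s z≤n) u u<s (ℕP.≤-trans (ℕP.<⇒≤ s<k) (ℕP.m≤m+n k u)))
  enough-present : e ⊓ s ≤ count P (downFrom s)
  enough-present = count-interval s 0 (e ⊓ s) P (ℕP.m⊓n≤n e s)
    (λ u _ u<e⊓s → present u (subst (s + u <_) s+e≡k (ℕP.+-monoʳ-< s (ℕP.<-≤-trans u<e⊓s (ℕP.m⊓n≤m e s)))))

bit≤1 : ∀ b → bit b ≤ 1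
bit≤1 true = s≤s z≤n
bit≤1 false = z≤n

bit-mono : ∀ {a b} → (a ≡ true → b ≡ true) → bit a ≤ bit b
bit-mono {true} a⇒b rewrite a⇒b refl = ℕP.≤-refl
bit-mono {false} a⇒b = z≤n

bit-disjoint : ∀ {a b} → (a ≡ true → b ≡ false) → bit a + bit b ≤ 1
bit-disjoint {true} a⇒¬b rewrite a⇒¬b refl = ℕP.≤-refl
bit-disjoint {false} {b} a⇒¬b = bit≤1 b

countBelow : (ℕ → Bool) → ℕ → ℕ
countBelow g zero = 0
countBelow g (suc n) = bit (g 0) + countBelow (λ i → g (suc i)) n

countBelow-cong : ∀ n {f g : ℕ → Bool} → (∀ i → f i ≡ g i) → countBelow f n ≡ countBelow g n
countBelow-cong zero f≗g = refl
countBelow-cong (suc n) f≗g = cong₂ _+_ (cong bit (f≗g 0)) (countBelow-cong n (λ i → f≗g (suc i)))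

countBelow-last : ∀ n g → countBelow g (suc n) ≡ countBelow g n + bit (g n)
countBelow-last zero g = ℕP.+-comm (bit (g 0)) 0
countBelow-last (suc n) g = trans (cong (ℕ._+_ (bit (g 0))) (countBelow-last n (λ i → g (suc i))))
  (sym (ℕP.+-assoc (bit (g 0)) _ _))

countBelow-≤ : ∀ n g → countBelow g n ≤ n
countBelow-≤ zero g = z≤n
countBelow-≤ (suc n) g = ℕP.+-mono-≤ (bit≤1 (g 0)) (countBelow-≤ n _)

countBelow-mono : ∀ n {f g : ℕ → Bool} → (∀ i → f i ≡ true → g i ≡ true) → countBelow f n ≤ countBelow g n
countBelow-mono zero f⊆g = z≤n
countBelow-mono (suc n) f⊆g = ℕP.+-mono-≤ (bit-mono (f⊆g 0)) (countBelow-mono n (λ i → f⊆g (suc i)))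

countBelow-strict : ∀ n {f g : ℕ → Bool} → (∀ i → f i ≡ true → g i ≡ true) →
  ∀ x → x < n → f x ≡ false → g x ≡ true → suc (countBelow f n) ≤ countBelow g n
countBelow-strict (suc n) {f} {g} f⊆g zero _ fx gx rewrite fx | gx =
  s≤s (countBelow-mono n (λ i → f⊆g (suc i)))
countBelow-strict (suc n) {f} {g} f⊆g (suc x) (s≤s x<n) fx gx = ℕP.≤-trans
  (ℕP.≤-reflexive (sym (ℕP.+-suc (bit (f 0)) _)))
  (ℕP.+-mono-≤ (bit-mono (f⊆g 0)) (countBelow-strict n (λ i → f⊆g (suc i)) x x<n fx gx))

countBelow-disjoint : ∀ n {f g : ℕ → Bool} → (∀ i → f i ≡ true → g i ≡ false) →
  countBelow f n + countBelow g n ≤ n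
countBelow-disjoint zero _ = z≤n
countBelow-disjoint (suc n) {f} {g} f∩g=∅ = ℕP.≤-trans
  (ℕP.≤-reflexive (shuffle (bit (f 0)) (bit (g 0)) _ _))
  (ℕP.+-mono-≤ (bit-disjoint (f∩g=∅ 0)) (countBelow-disjoint n (λ i → f∩g=∅ (suc i))))
  where
  shuffle : ∀ a b c d → (a + c) + (b + d) ≡ (a + b) + (c + d)
  shuffle = ℕSolver.solve-∀

countBelow-empty : ∀ n {g : ℕ → Bool} → (∀ i → i < n → g i ≡ false) → countBelow g n ≡ 0
countBelow-empty zero _ = refl
countBelow-empty (suc n) {g} empty rewrite empty 0 (s≤s z≤n) =
  countBelow-empty n (λ i i<n → empty (suc i) (s≤s i<n))

countBelow-witness : ∀ n {g : ℕ → Bool} → 1 ≤ countBelow g n → ∃ λ i → g i ≡ true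
countBelow-witness (suc n) {g} pos with g 0 in g0
... | true = 0 , g0
... | false with countBelow-witness n {λ i → g (suc i)} pos
... | i , gi = suc i , gi

all-or-counterexample : ∀ n (g : ℕ → Bool) → (∀ i → i < n → g i ≡ true) ⊎ (∃ λ i → i < n × g i ≡ false)
all-or-counterexample zero g = inj₁ (λ i ())
all-or-counterexample (suc n) g with g 0 in g0
... | false = inj₂ (0 , s≤s z≤n , g0)
... | true with all-or-counterexample n (λ i → g (suc i))
... | inj₂ (i , i<n , gi) = inj₂ (suc i , s≤s i<n , gi)
... | inj₁ all = inj₁ λ { zero _ → g0 ; (suc i) (s≤s i<n) → all i i<n }

switch : ∀ (C : ℕ → Bool) i d → C i ≡ true → C (i + d) ≡ false →
  ∃ λ j → C (i + j) ≡ true × C (suc (i + j)) ≡ false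
switch C i zero Ci Ci+0 = contradiction (trans (sym Ci) (trans (cong C (sym (ℕP.+-identityʳ i))) Ci+0)) λ ()
switch C i (suc d) Ci Ci+d+1 with C (i + d) in Ci+d
... | true = d , Ci+d , trans (cong C (sym (ℕP.+-suc i d))) Ci+d+1
... | false = switch C i d Ci Ci+d

count-tabulate : ∀ {A : Set} n (h : Fin n → A) (P : A → Bool) (g : ℕ → Bool) →
  (∀ a → P (h a) ≡ g (toℕ a)) → count P (List.tabulate h) ≡ countBelow g n
count-tabulate zero h P g agree = refl
count-tabulate (suc n) h P g agree = cong₂ _+_ (cong bit (agree Fin.zero))
  (count-tabulate n (λ a → h (Fin.suc a)) P (λ i → g (suc i)) (λ a → agree (Fin.suc a)))

-- Subsets of ℤ_m, m = M + 1, are represented by m-periodic predicates on ℕ;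
-- the shift i ↦ i + M is the rotation by -1.  The key fact is a
-- Cauchy–Davenport inequality for an interval: if A - s is disjoint from
-- B + {0, 1, …, J}, then |A| + |B| + J ≤ m.
module Cyclic (M : ℕ) where

  m : ℕ
  m = suc M

  Periodic : (ℕ → Bool) → Set
  Periodic g = ∀ i → g (i + m) ≡ g i

  periodic-multiple : ∀ {g} → Periodic g → ∀ q i → g (i + q * m) ≡ g i
  periodic-multiple {g} per zero i = cong g (ℕP.+-identityʳ i)
  periodic-multiple {g} per (suc q) i =
    trans (cong g (shuffle i q m)) (trans (per (i + q * m)) (periodic-multiple per q i))
    where
    shuffle : ∀ i q m → i + (m + q * m) ≡ (i + q * m) + m
    shuffle = ℕSolver.solve-∀

  periodic-mod : ∀ {g} → Periodic g → ∀ i → g (i % m) ≡ g i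
  periodic-mod {g} per i =
    trans (sym (periodic-multiple per (i / m) (i % m))) (cong g (sym (m≡m%n+[m/n]*n i m)))

  count-rotate : ∀ {g} → Periodic g → ∀ k → countBelow (λ i → g (i + k)) m ≡ countBelow g m
  count-rotate {g} per zero = countBelow-cong m (λ i → cong g (ℕP.+-identityʳ i))
  count-rotate {g} per (suc k) = begin
    countBelow (λ i → g (i + suc k)) m   ≡⟨ countBelow-cong m (λ i → cong g (ℕP.+-suc i k)) ⟩
    countBelow (λ i → g' (suc i)) m      ≡⟨ rotate-by-one ⟩
    countBelow g' m                      ≡⟨ count-rotate per k ⟩
    countBelow g m                       ∎
    where
    open ≡-Reasoning
    g' : ℕ → Bool
    g' i = g (i + k)
    g'-periodic : g' m ≡ g' 0
    g'-periodic = trans (cong g (ℕP.+-comm m k)) (per k)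
    rotate-by-one : countBelow (λ i → g' (suc i)) m ≡ countBelow g' m
    rotate-by-one = ℕP.+-cancelˡ-≡ (bit (g' 0)) _ _ (begin
      countBelow g' (suc m)             ≡⟨ countBelow-last m g' ⟩
      countBelow g' m + bit (g' m)      ≡⟨ cong (λ b → countBelow g' m + bit b) g'-periodic ⟩
      countBelow g' m + bit (g' 0)      ≡⟨ ℕP.+-comm (countBelow g' m) _ ⟩
      bit (g' 0) + countBelow g' m      ∎)

  boundary : ∀ C → Periodic C → ∀ {i₁ i₀} → C i₁ ≡ true → C i₀ ≡ false →
    ∃ λ x → x < m × C x ≡ false × C (x + M) ≡ true
  boundary C per {i₁} {i₀} Ci₁ Ci₀ with switch C i₁ (i₀ + i₁ * M) Ci₁ far-end
    where
    far-end : C (i₁ + (i₀ + i₁ * M)) ≡ false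
    far-end = trans (cong C (shuffle i₀ i₁ M)) (trans (periodic-multiple per i₁ i₀) Ci₀)
      where
      shuffle : ∀ i₀ i₁ M → i₁ + (i₀ + i₁ * M) ≡ i₀ + i₁ * suc M
      shuffle = ℕSolver.solve-∀
  ... | j , Cy , Cy+1 = x , m%n<n (suc y) m , trans (periodic-mod per (suc y)) Cy+1 ,
        trans (sym (periodic-multiple per (suc y / m) (x + M))) (trans (cong C x+M≡y+m) (trans (per y) Cy))
    where
    y = i₁ + j
    x = suc y % m
    x+M≡y+m : x + M + (suc y / m) * m ≡ y + m
    x+M≡y+m = begin
      x + M + (suc y / m) * m   ≡⟨ shuffle x M _ ⟩
      x + (suc y / m) * m + M   ≡⟨ cong (_+ M) (sym (m≡m%n+[m/n]*n (suc y) m)) ⟩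
      suc y + M                 ≡⟨ sym (ℕP.+-suc y M) ⟩
      y + m                     ∎
      where
      open ≡-Reasoning
      shuffle : ∀ a b c → a + b + c ≡ a + c + b
      shuffle = ℕSolver.solve-∀

  spread : (ℕ → Bool) → ℕ → Bool
  spread C i = C i ∨ C (i + M)

  spread-periodic : ∀ {C} → Periodic C → Periodic (spread C)
  spread-periodic {C} per i = cong₂ _∨_ (per i) (trans (cong C (shuffle i m M)) (per (i + M)))
    where
    shuffle : ∀ a b c → a + b + c ≡ a + c + b
    shuffle = ℕSolver.solve-∀

  spread-⊇ : ∀ C i → C i ≡ true → spread C i ≡ true
  spread-⊇ C i Ci rewrite Ci = refl

  spread-grows : ∀ C → Periodic C → ∀ {i₁ i₀} → C i₁ ≡ true → i₀ < m → C i₀ ≡ false →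
    suc (countBelow C m) ≤ countBelow (spread C) m
  spread-grows C per Ci₁ _ Ci₀ with boundary C per Ci₁ Ci₀
  ... | x , x<m , Cx , Cx-1 = countBelow-strict m (spread-⊇ C) x x<m Cx (subst (λ b → (b ∨ C (x + M)) ≡ true) (sym Cx) Cx-1)

  spreadⁿ : ℕ → (ℕ → Bool) → ℕ → Bool
  spreadⁿ zero B = B
  spreadⁿ (suc j) B = spread (spreadⁿ j B)

  spreadⁿ-periodic : ∀ j {B} → Periodic B → Periodic (spreadⁿ j B)
  spreadⁿ-periodic zero per = per
  spreadⁿ-periodic (suc j) per = spread-periodic (spreadⁿ-periodic j per)

  spreadⁿ-⊇ : ∀ j B i → B i ≡ true → spreadⁿ j B i ≡ true
  spreadⁿ-⊇ zero B i Bi = Bi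
  spreadⁿ-⊇ (suc j) B i Bi = spread-⊇ (spreadⁿ j B) i (spreadⁿ-⊇ j B i Bi)

  spreadⁿ-witness : ∀ j B i → spreadⁿ j B i ≡ true → ∃ λ t → t ≤ j × B (i + t * M) ≡ true
  spreadⁿ-witness zero B i Bi = 0 , z≤n , trans (cong B (ℕP.+-identityʳ i)) Bi
  spreadⁿ-witness (suc j) B i hit with spreadⁿ j B i in here
  ... | true with spreadⁿ-witness j B i here
  ...   | t , t≤j , Bt = t , ℕP.m≤n⇒m≤1+n t≤j , Bt
  spreadⁿ-witness (suc j) B i hit | false with spreadⁿ-witness j B (i + M) hit
  ...   | t , t≤j , Bt = suc t , s≤s t≤j , trans (cong B (sym (ℕP.+-assoc i M (t * M)))) Bt

  spreadⁿ-grows : ∀ j B → Periodic B → 1 ≤ countBelow B m →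
    (countBelow B m + j ≤ countBelow (spreadⁿ j B) m) ⊎ (∀ i → i < m → spreadⁿ j B i ≡ true)
  spreadⁿ-grows zero B per pos = inj₁ (ℕP.≤-reflexive (ℕP.+-identityʳ _))
  spreadⁿ-grows (suc j) B per pos with spreadⁿ-grows j B per pos
  ... | inj₂ full = inj₂ (λ i i<m → spread-⊇ (spreadⁿ j B) i (full i i<m))
  ... | inj₁ big with all-or-counterexample m (spreadⁿ j B) | countBelow-witness m pos
  ...   | inj₁ full | _ = inj₂ (λ i i<m → spread-⊇ (spreadⁿ j B) i (full i i<m))
  ...   | inj₂ (i₀ , i₀<m , miss) | i₁ , Bi₁ = inj₁ (begin
    countBelow B m + suc j                 ≡⟨ ℕP.+-suc (countBelow B m) j ⟩
    suc (countBelow B m + j)               ≤⟨ s≤s big ⟩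
    suc (countBelow (spreadⁿ j B) m)       ≤⟨ spread-grows (spreadⁿ j B) (spreadⁿ-periodic j per) (spreadⁿ-⊇ j B i₁ Bi₁) i₀<m miss ⟩
    countBelow (spreadⁿ (suc j) B) m       ∎)
    where open ℕP.≤-Reasoning

  sumset-bound : ∀ A B → Periodic A → Periodic B → ∀ s J →
    (∀ i t → t ≤ J → B (i + t * M) ≡ true → A (i + s) ≡ false) →
    1 ≤ countBelow A m → 1 ≤ countBelow B m → countBelow A m + (countBelow B m + J) ≤ m
  sumset-bound A B perA perB s J avoid posA posB = bound (spreadⁿ-grows J B perB posB)
    where
    avoid-spread : ∀ i → spreadⁿ J B i ≡ true → A (i + s) ≡ false
    avoid-spread i hit with spreadⁿ-witness J B i hit
    ... | t , t≤J , Bt = avoid i t t≤J Bt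
    disjoint : ∀ i → A (i + s) ≡ true → spreadⁿ J B i ≡ false
    disjoint i As with spreadⁿ J B i in hit
    ... | false = refl
    ... | true = contradiction (trans (sym As) (avoid-spread i hit)) λ ()
    bound : (countBelow B m + J ≤ countBelow (spreadⁿ J B) m) ⊎ (∀ i → i < m → spreadⁿ J B i ≡ true) →
      countBelow A m + (countBelow B m + J) ≤ m
    bound (inj₂ full) = contradiction (ℕP.≤-trans posA (ℕP.≤-reflexive (begin
      countBelow A m                       ≡⟨ sym (count-rotate perA s) ⟩
      countBelow (λ i → A (i + s)) m       ≡⟨ countBelow-empty m (λ i i<m → avoid-spread i (full i i<m)) ⟩
      0                                    ∎))) λ ()
      where open ≡-Reasoning
    bound (inj₁ big) = begin
      countBelow A m + (countBelow B m + J)                       ≤⟨ ℕP.+-monoʳ-≤ (countBelow A m) big ⟩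
      countBelow A m + countBelow (spreadⁿ J B) m                 ≡⟨ cong (_+ countBelow (spreadⁿ J B) m) (sym (count-rotate perA s)) ⟩
      countBelow (λ i → A (i + s)) m + countBelow (spreadⁿ J B) m ≤⟨ countBelow-disjoint m disjoint ⟩
      m                                                           ∎
      where open ℕP.≤-Reasoning

no-multiple-below : ∀ {m v} → m ∣ℕ v → 0 < v → v < m → ⊥
no-multiple-below {v = suc v} m∣v _ v<m = ℕP.<-irrefl refl (ℕP.<-≤-trans v<m (∣⇒≤ m∣v))

agree-sym : ∀ {m s} (a b : Fin m) → AgreeZ m s b a → AgreeZ m s a b
agree-sym {m} {s} a b (k , ∣k∣<s , m∣b-a-k) = ℤ.- k , subst (_< s) (sym (ℤP.∣-i∣≡∣i∣ k)) ∣k∣<s ,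
  subst (m ∣ℕ_) (sym (trans (cong ℤ.∣_∣ (negate (+ toℕ a) (+ toℕ b) k)) (ℤP.∣-i∣≡∣i∣ ((+ toℕ b ℤ.- + toℕ a) ℤ.- k)))) m∣b-a-k
  where
  open ℤSolver
  negate : ∀ (a b k : ℤ) → (a ℤ.- b) ℤ.- (ℤ.- k) ≡ ℤ.- ((b ℤ.- a) ℤ.- k)
  negate = solve-∀

-- Distance in ℤ_m, m = M + 1, with the agreement radius s and 2s ≤ m.
-- a is far from b when a - b ∈ {s, s + 1, …, m - s}; far points never s-agree,
-- and two nonempty sets with no far pair have at most 2s elements in total.
module Distance (M s : ℕ) (2s≤m : s + s ≤ suc M) where

  open Cyclic M public using (m)
  open Cyclic M using (Periodic; sumset-bound)

  -- the number of far differences, minus one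
  J : ℕ
  J = m ∸ (s + s)

  J+2s≡m : J + (s + s) ≡ m
  J+2s≡m = ℕP.m∸n+n≡m 2s≤m

  Far : Fin m → Fin m → Set
  Far a b = ∃ λ (t : Fin (suc J)) → toℕ a ≡ (toℕ b + (s + toℕ t)) % m

  far? : ∀ a b → Dec (Far a b)
  far? a b = FinP.any? (λ t → toℕ a ℕP.≟ (toℕ b + (s + toℕ t)) % m)

  gap-not-multiple : ∀ d k → ℤ.∣ k ∣ < s → s ≤ d → d + s ≤ m → ¬ (+ m ℤDiv.∣ (+ d ℤ.- k))
  gap-not-multiple d (+ k) k<s s≤d d+s≤m m∣d-k = no-multiple-below
    (subst (m ∣ℕ_) (cong ℤ.∣_∣ (trans (ℤP.m-n≡m⊖n d k) (ℤP.⊖-≥ (ℕP.<⇒≤ k<d)))) (ℤDiv.∣⇒∣ᵤ m∣d-k))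
    (ℕP.m<n⇒0<n∸m k<d)
    (ℕP.≤-<-trans (ℕP.m∸n≤m d k) (ℕP.<-≤-trans (ℕP.m<m+n d (ℕP.≤-<-trans z≤n k<s)) d+s≤m))
    where
    k<d : k < d
    k<d = ℕP.<-≤-trans k<s s≤d
  gap-not-multiple d -[1+ k ] k<s s≤d d+s≤m m∣d-k = no-multiple-below
    (ℤDiv.∣⇒∣ᵤ m∣d-k)
    (ℕP.≤-trans (s≤s z≤n) (ℕP.≤-reflexive (sym (ℕP.+-suc d k))))
    (ℕP.<-≤-trans (ℕP.+-monoʳ-< d k<s) d+s≤m)

  far-difference : ∀ a b → Far a b →
    ∃ λ d → s ≤ d × d + s ≤ m × + m ℤDiv.∣ ((+ toℕ a ℤ.- + toℕ b) ℤ.- + d)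
  far-difference a b (t , a≡b+d) = d , ℕP.m≤m+n s (toℕ t) , d+s≤m , m∣a-b-d
    where
    d = s + toℕ t
    q = (toℕ b + d) / m
    qm = + q ℤ.* + m
    d+s≤m : d + s ≤ m
    d+s≤m = begin
      s + toℕ t + s   ≡⟨ ℕP.+-comm (s + toℕ t) s ⟩
      s + (s + toℕ t) ≡⟨ sym (ℕP.+-assoc s s (toℕ t)) ⟩
      s + s + toℕ t   ≤⟨ ℕP.+-monoʳ-≤ (s + s) (FinP.toℕ≤pred[n] t) ⟩
      s + s + J       ≡⟨ trans (ℕP.+-comm (s + s) J) J+2s≡m ⟩
      m               ∎
      where open ℕP.≤-Reasoning
    a+qm≡b+d : + toℕ a ℤ.+ qm ≡ + toℕ b ℤ.+ + d
    a+qm≡b+d = begin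
      + toℕ a ℤ.+ + q ℤ.* + m   ≡⟨ cong (ℤ._+_ (+ toℕ a)) (sym (ℤP.pos-* q m)) ⟩
      + toℕ a ℤ.+ + (q * m)     ≡⟨ sym (ℤP.pos-+ (toℕ a) (q * m)) ⟩
      + (toℕ a + q * m)         ≡⟨ cong (λ r → + (r + q * m)) a≡b+d ⟩
      + ((toℕ b + d) % m + q * m) ≡⟨ cong +_ (sym (m≡m%n+[m/n]*n (toℕ b + d) m)) ⟩
      + (toℕ b + d)             ≡⟨ ℤP.pos-+ (toℕ b) d ⟩
      + toℕ b ℤ.+ + d           ∎
      where open ≡-Reasoning
    a-b-d≡-qm : (+ toℕ a ℤ.- + toℕ b) ℤ.- + d ≡ ℤ.- qm
    a-b-d≡-qm = begin
      (+ toℕ a ℤ.- + toℕ b) ℤ.- + d                      ≡⟨ rearrange (+ toℕ a) (+ toℕ b) (+ d) qm ⟩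
      ((+ toℕ a ℤ.+ qm) ℤ.- (+ toℕ b ℤ.+ + d)) ℤ.- qm  ≡⟨ cong (λ z → (z ℤ.- (+ toℕ b ℤ.+ + d)) ℤ.- qm) a+qm≡b+d ⟩
      ((+ toℕ b ℤ.+ + d) ℤ.- (+ toℕ b ℤ.+ + d)) ℤ.- qm  ≡⟨ cong (ℤ._- qm) (ℤP.+-inverseʳ (+ toℕ b ℤ.+ + d)) ⟩
      ℤ.0ℤ ℤ.- qm                                       ≡⟨ ℤP.+-identityˡ (ℤ.- qm) ⟩
      ℤ.- qm                                            ∎
      where
      open ≡-Reasoning
      open ℤSolver
      rearrange : ∀ (a b d qm : ℤ) → (a ℤ.- b) ℤ.- d ≡ ((a ℤ.+ qm) ℤ.- (b ℤ.+ d)) ℤ.- qm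
      rearrange = solve-∀
    m∣a-b-d : + m ℤDiv.∣ ((+ toℕ a ℤ.- + toℕ b) ℤ.- + d)
    m∣a-b-d = subst (+ m ℤDiv.∣_) (sym a-b-d≡-qm) (ℤDiv.∣m⇒∣-m (ℤDiv.∣n⇒∣m*n (+ q) ℤDiv.∣-refl))

  -- If a - b ≡ d and a - b ≡ k with |k| < s, then m ∣ d - k, which gap-not-multiple forbids.
  far-disagrees : ∀ a b → Far a b → ¬ AgreeZ m s a b
  far-disagrees a b far (k , ∣k∣<s , m∣a-b-k) with far-difference a b far
  ... | d , s≤d , d+s≤m , m∣a-b-d = gap-not-multiple d k ∣k∣<s s≤d d+s≤m
    (subst (+ m ℤDiv.∣_) (difference (+ toℕ a ℤ.- + toℕ b) (+ d) k)
      (ℤDiv.∣m∣n⇒∣m-n {m = (+ toℕ a ℤ.- + toℕ b) ℤ.- k} (ℤDiv.∣ᵤ⇒∣ m∣a-b-k) m∣a-b-d))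
    where
    open ℤSolver
    difference : ∀ (x d k : ℤ) → (x ℤ.- k) ℤ.- (x ℤ.- d) ≡ d ℤ.- k
    difference = solve-∀

  residue : ℕ → Fin m
  residue i = fromℕ< (m%n<n i m)

  lift : (Fin m → Bool) → ℕ → Bool
  lift A i = A (residue i)

  lift-periodic : ∀ A → Periodic (lift A)
  lift-periodic A i = cong A (FinP.toℕ-injective
    (trans (FinP.toℕ-fromℕ< _) (trans ([m+n]%n≡m%n i m) (sym (FinP.toℕ-fromℕ< _)))))

  count-lift : ∀ A → count A (allFin m) ≡ countBelow (lift A) m
  count-lift A = count-tabulate m (λ a → a) A (lift A) (λ a → cong A (sym (residue-toℕ a)))
    where
    residue-toℕ : ∀ a → residue (toℕ a) ≡ a
    residue-toℕ a = FinP.toℕ-injective (trans (FinP.toℕ-fromℕ< _) (m<n⇒m%n≡m (FinP.toℕ<n a)))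

  -- i + s is far from i + t(m - 1) = i - t for every t ≤ J.
  far-shift : ∀ i t → t ≤ J → Far (residue (i + s)) (residue (i + t * M))
  far-shift i t t≤J = fromℕ< (s≤s t≤J) , (begin
    toℕ (residue (i + s))                                          ≡⟨ FinP.toℕ-fromℕ< _ ⟩
    (i + s) % m                                                    ≡⟨ sym ([m+kn]%n≡m%n (i + s) t m) ⟩
    ((i + s) + t * m) % m                                          ≡⟨ cong (_% m) (shuffle i s t M) ⟩
    (i + t * M + (s + t)) % m                                      ≡⟨ sym (mod-absorb (i + t * M) (s + t)) ⟩
    ((i + t * M) % m + (s + t)) % m                                ≡⟨ cong₂ (λ x y → (x + (s + y)) % m)
                                                                        (sym (FinP.toℕ-fromℕ< (m%n<n (i + t * M) m))) (sym (FinP.toℕ-fromℕ< (s≤s t≤J))) ⟩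
    (toℕ (residue (i + t * M)) + (s + toℕ (fromℕ< (s≤s t≤J)))) % m ∎)
    where
    open ≡-Reasoning
    shuffle : ∀ i s t M → (i + s) + t * suc M ≡ i + t * M + (s + t)
    shuffle = ℕSolver.solve-∀
    mod-absorb : ∀ x y → (x % m + y) % m ≡ (x + y) % m
    mod-absorb x y = sym (trans (cong (λ v → (v + y) % m) (m≡m%n+[m/n]*n x m))
      (trans (cong (_% m) (swap (x % m) ((x / m) * m) y)) ([m+kn]%n≡m%n (x % m + y) (x / m) m)))
      where
      swap : ∀ a b c → a + b + c ≡ a + c + b
      swap = ℕSolver.solve-∀

  no-far-pair-bound : ∀ (A B : Fin m → Bool) → (∀ a b → A a ≡ true → B b ≡ true → ¬ Far a b) →
    1 ≤ count A (allFin m) → 1 ≤ count B (allFin m) → count A (allFin m) + count B (allFin m) ≤ s + s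
  no-far-pair-bound A B no-far posA posB = ℕP.+-cancelʳ-≤ J _ _ (begin
    count A (allFin m) + count B (allFin m) + J     ≡⟨ ℕP.+-assoc (count A (allFin m)) _ J ⟩
    count A (allFin m) + (count B (allFin m) + J)   ≡⟨ cong₂ (λ a b → a + (b + J)) (count-lift A) (count-lift B) ⟩
    countBelow (lift A) m + (countBelow (lift B) m + J)
      ≤⟨ sumset-bound (lift A) (lift B) (lift-periodic A) (lift-periodic B) s J avoid
           (subst (1 ≤_) (count-lift A) posA) (subst (1 ≤_) (count-lift B) posB) ⟩
    m                                               ≡⟨ sym J+2s≡m ⟩
    J + (s + s)                                     ≡⟨ ℕP.+-comm J (s + s) ⟩
    s + s + J                                       ∎)
    where
    open ℕP.≤-Reasoning
    avoid : ∀ i t → t ≤ J → lift B (i + t * M) ≡ true → lift A (i + s) ≡ false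
    avoid i t t≤J Bi-t with lift A (i + s) in Ai+s
    ... | false = refl
    ... | true = contradiction (far-shift i t t≤J) (no-far _ _ Ai+s Bi-t)

agreement-to-one : ∀ {m s t n ℓ} (x₁ x₂ : Vec (Fin m) n) (y₁ y₂ : Vec Bool ℓ) a b →
  AgreeOnAtLeast m s t (a ∷ x₁ , y₁) (b ∷ x₂ , y₂) →
  AgreeOnAtLeast m s t (x₁ , true ∷ y₁) (x₂ , true ∷ y₂)
agreement-to-one x₁ x₂ y₁ y₂ a b (c ∷ S₁ , S₂ , t≤ , agreeZ , agreeB) =
  S₁ , true ∷ S₂ , ℕP.≤-trans t≤ (size-moves c) , (λ i i∈S₁ → agreeZ (Fin.suc i) (there i∈S₁)) , agreeB′
  where
  size-moves : ∀ c → ∣ c ∷ S₁ ∣ + ∣ S₂ ∣ ≤ ∣ S₁ ∣ + ∣ true ∷ S₂ ∣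
  size-moves true = ℕP.≤-reflexive (sym (ℕP.+-suc ∣ S₁ ∣ ∣ S₂ ∣))
  size-moves false = ℕP.≤-trans (ℕP.n≤1+n _) (ℕP.≤-reflexive (sym (ℕP.+-suc ∣ S₁ ∣ ∣ S₂ ∣)))
  agreeB′ : ∀ j → j ∈ (true ∷ S₂) → AgreeB (lookup (true ∷ y₁) j) (lookup (true ∷ y₂) j)
  agreeB′ Fin.zero here = refl , refl
  agreeB′ (Fin.suc j) (there j∈S₂) = agreeB j j∈S₂

agreement-without-first : ∀ {m s t n ℓ} (x₁ x₂ : Vec (Fin m) n) (y₁ y₂ : Vec Bool ℓ) a b c₁ c₂ →
  ¬ AgreeZ m s a b → AgreeOnAtLeast m s t (a ∷ x₁ , y₁) (b ∷ x₂ , y₂) →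
  AgreeOnAtLeast m s t (x₁ , c₁ ∷ y₁) (x₂ , c₂ ∷ y₂)
agreement-without-first x₁ x₂ y₁ y₂ a b c₁ c₂ disagree (true ∷ S₁ , S₂ , t≤ , agreeZ , agreeB) =
  contradiction (agreeZ Fin.zero here) disagree
agreement-without-first x₁ x₂ y₁ y₂ a b c₁ c₂ disagree (false ∷ S₁ , S₂ , t≤ , agreeZ , agreeB) =
  S₁ , false ∷ S₂ , t≤ , (λ i i∈S₁ → agreeZ (Fin.suc i) (there i∈S₁)) , agreeB′
  where
  agreeB′ : ∀ j → j ∈ (false ∷ S₂) → AgreeB (lookup (c₁ ∷ y₁) j) (lookup (c₂ ∷ y₂) j)
  agreeB′ (Fin.suc j) (there j∈S₂) = agreeB j j∈S₂

decided : ∀ {P : Set} (P? : Dec P) → does P? ≡ true → P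
decided (yes p) _ = p

∈-concatMap : ∀ {A B : Set} (f : A → List B) {x y xs} → x ∈ₗ xs → y ∈ₗ f x → y ∈ₗ concatMap f xs
∈-concatMap f x∈xs y∈fx = ∈-concatMap⁺ f (Any.map (λ { refl → y∈fx }) x∈xs)

allFinVecs-complete : ∀ m n (x : Vec (Fin m) n) → x ∈ₗ allFinVecs m n
allFinVecs-complete m zero [] = Any.here refl
allFinVecs-complete m (suc n) (a ∷ x) =
  ∈-concatMap (λ a → map (a ∷_) (allFinVecs m n)) (∈-allFin a) (∈-map⁺ (a ∷_) (allFinVecs-complete m n x))

allBoolVecs-complete : ∀ ℓ (y : Vec Bool ℓ) → y ∈ₗ allBoolVecs ℓ
allBoolVecs-complete zero [] = Any.here refl
allBoolVecs-complete (suc ℓ) (true ∷ y) = ∈-++⁺ˡ (∈-map⁺ (true ∷_) (allBoolVecs-complete ℓ y))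
allBoolVecs-complete (suc ℓ) (false ∷ y) =
  ∈-++⁺ʳ (map (true ∷_) (allBoolVecs ℓ)) (∈-map⁺ (false ∷_) (allBoolVecs-complete ℓ y))

module Compression (M s n ℓ t : ℕ) (2s≤m : s + s ≤ suc M)
                   (F : Family (suc M) (suc n) ℓ) (F-agreeing : TAgreeing (suc M) s t F) where

  open Distance M s 2s≤m public

  Point : Set
  Point = Vec (Fin m) n × Vec Bool ℓ

  fibre : Point → Fin m → Bool
  fibre (x , y) a = F (a ∷ x) y

  size : Point → ℕ
  size p = count (fibre p) (allFin m)

  size≤m : ∀ p → size p ≤ m
  size≤m p = subst (_≤ m) (sym (count-lift (fibre p))) (countBelow-≤ m (lift (fibre p)))

  Incompatible : Point → Point → Set
  Incompatible p q = ∃[ a ] ∃[ b ] (fibre p a ≡ true × fibre q b ≡ true × Far a b)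

  incompatible? : ∀ p q → Dec (Incompatible p q)
  incompatible? p q = FinP.any? λ a → FinP.any? λ b →
    (fibre p a BoolP.≟ true) ×-dec (fibre q b BoolP.≟ true) ×-dec far? a b

  compatible-bound : ∀ p q → ¬ Incompatible p q → 1 ≤ size p → 1 ≤ size q → size p + size q ≤ s + s
  compatible-bound p q compatible =
    no-far-pair-bound (fibre p) (fibre q) (λ a b pa qb far → compatible (a , b , pa , qb , far))

  points : List Point
  points = concatMap (λ x → map (x ,_) (allBoolVecs ℓ)) (allFinVecs m n)

  points-complete : ∀ p → p ∈ₗ points
  points-complete (x , y) = ∈-concatMap (λ x → map (x ,_) (allBoolVecs ℓ))
    (allFinVecs-complete m n x) (∈-map⁺ (x ,_) (allBoolVecs-complete ℓ y))

  Killed : ℕ → Point → Set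
  Killed θ p = Any (λ q → θ < size q × ¬ Incompatible p q) points

  killed? : ∀ θ p → Dec (Killed θ p)
  killed? θ p = Any.any? (λ q → (θ ℕP.<? size q) ×-dec ¬? (incompatible? p q)) points

  killed-small : ∀ θ p → Killed θ p → 1 ≤ size p → size p + suc θ ≤ s + s
  killed-small θ p killed pos with Any.satisfied killed
  ... | q , θ<q , compatible = ℕP.≤-trans (ℕP.+-monoʳ-≤ (size p) θ<q)
    (compatible-bound p q compatible pos (ℕP.≤-trans (s≤s z≤n) θ<q))

  survivor-incompatible : ∀ θ p q → ¬ Killed θ p → θ < size q → Incompatible p q
  survivor-incompatible θ p q alive θ<q with incompatible? p q
  ... | yes incompatible = incompatible
  ... | no compatible = contradiction (Any.map (λ { refl → θ<q , compatible }) (points-complete q)) alive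

  H : ℕ → Family m n (suc ℓ)
  H θ x (true ∷ y) = does ((1 ℕP.≤? size (x , y)) ×-dec ¬? (killed? θ (x , y)))
  H θ x (false ∷ y) = does (θ ℕP.<? size (x , y))

  H-one : ∀ θ x y → H θ x (true ∷ y) ≡ true → 1 ≤ size (x , y) × ¬ Killed θ (x , y)
  H-one θ x y = decided ((1 ℕP.≤? size (x , y)) ×-dec ¬? (killed? θ (x , y)))

  H-zero : ∀ θ x y → H θ x (false ∷ y) ≡ true → θ < size (x , y)
  H-zero θ x y = decided (θ ℕP.<? size (x , y))

  H-zero-if : ∀ θ x y → θ < size (x , y) → H θ x (false ∷ y) ≡ true
  H-zero-if θ x y = dec-true (θ ℕP.<? size (x , y))

  H-one-if : ∀ θ x y → 1 ≤ size (x , y) → s + s < size (x , y) + suc θ → H θ x (true ∷ y) ≡ true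
  H-one-if θ x y pos big = dec-true ((1 ℕP.≤? size (x , y)) ×-dec ¬? (killed? θ (x , y)))
    (pos , λ killed → ℕP.<⇒≱ big (killed-small θ (x , y) killed pos))

  from-incompatible : ∀ x₁ y₁ x₂ y₂ c₁ c₂ → Incompatible (x₁ , y₁) (x₂ , y₂) →
    AgreeOnAtLeast m s t (x₁ , c₁ ∷ y₁) (x₂ , c₂ ∷ y₂)
  from-incompatible x₁ y₁ x₂ y₂ c₁ c₂ (a , b , Fa , Fb , far) = agreement-without-first x₁ x₂ y₁ y₂ a b c₁ c₂
    (far-disagrees a b far) (F-agreeing (a ∷ x₁) y₁ (b ∷ x₂) y₂ Fa Fb)

  H-agreeing : ∀ θ → s ≤ θ → TAgreeing m s t (H θ)
  H-agreeing θ s≤θ x₁ (true ∷ y₁) x₂ (true ∷ y₂) H₁ H₂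
    with count-witness (fibre (x₁ , y₁)) (allFin m) (proj₁ (H-one θ x₁ y₁ H₁))
       | count-witness (fibre (x₂ , y₂)) (allFin m) (proj₁ (H-one θ x₂ y₂ H₂))
  ... | a , Fa | b , Fb = agreement-to-one x₁ x₂ y₁ y₂ a b (F-agreeing (a ∷ x₁) y₁ (b ∷ x₂) y₂ Fa Fb)
  H-agreeing θ s≤θ x₁ (false ∷ y₁) x₂ (false ∷ y₂) H₁ H₂ with incompatible? (x₁ , y₁) (x₂ , y₂)
  ... | yes incompatible = from-incompatible x₁ y₁ x₂ y₂ false false incompatible
  ... | no compatible = contradiction
    (compatible-bound (x₁ , y₁) (x₂ , y₂) compatible (ℕP.≤-trans (s≤s z≤n) θ<₁) (ℕP.≤-trans (s≤s z≤n) θ<₂))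
    (ℕP.<⇒≱ (ℕP.+-mono-< (ℕP.≤-<-trans s≤θ θ<₁) (ℕP.≤-<-trans s≤θ θ<₂)))
    where
    θ<₁ = H-zero θ x₁ y₁ H₁
    θ<₂ = H-zero θ x₂ y₂ H₂
  H-agreeing θ s≤θ x₁ (true ∷ y₁) x₂ (false ∷ y₂) H₁ H₂ = from-incompatible x₁ y₁ x₂ y₂ true false
    (survivor-incompatible θ (x₁ , y₁) (x₂ , y₂) (proj₂ (H-one θ x₁ y₁ H₁)) (H-zero θ x₂ y₂ H₂))
  H-agreeing θ s≤θ x₁ (false ∷ y₁) x₂ (true ∷ y₂) H₁ H₂
    with survivor-incompatible θ (x₂ , y₂) (x₁ , y₁) (proj₂ (H-one θ x₂ y₂ H₂)) (H-zero θ x₁ y₁ H₁)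
  ... | b , a , Fb , Fa , far = agreement-without-first x₁ x₂ y₁ y₂ a b false true
    (λ agree → far-disagrees b a far (agree-sym b a agree)) (F-agreeing (a ∷ x₁) y₁ (b ∷ x₂) y₂ Fa Fb)

module Averaging (M s n ℓ t : ℕ) (2s≤m : s + s ≤ suc M)
                 (F : Family (suc M) (suc n) ℓ) (F-agreeing : TAgreeing (suc M) s t F) where

  open Compression M s n ℓ t 2s≤m F F-agreeing public
  open UnitFraction M

  xs : List (Vec (Fin m) n)
  xs = allFinVecs m n

  ys : List (Vec Bool ℓ)
  ys = allBoolVecs ℓ

  p q : ℚ
  p = + s ℚ./ m
  q = 1ℚ ℚ.- p

  q-fraction : q ≡ ι (m ∸ s) ℚ.* unit
  q-fraction = begin
    1ℚ ℚ.- p                                          ≡⟨ cong₂ ℚ._-_ (sym fraction-whole) (fraction s) ⟩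
    ι m ℚ.* unit ℚ.- ι s ℚ.* unit                     ≡⟨ cong (λ k → ι k ℚ.* unit ℚ.- ι s ℚ.* unit) (sym m≡s+[m-s]) ⟩
    ι (s + (m ∸ s)) ℚ.* unit ℚ.- ι s ℚ.* unit         ≡⟨ cong (λ z → z ℚ.* unit ℚ.- ι s ℚ.* unit) (ι-+ s (m ∸ s)) ⟩
    (ι s ℚ.+ ι (m ∸ s)) ℚ.* unit ℚ.- ι s ℚ.* unit     ≡⟨ solve 3 (λ a b u → (a :+ b) :* u :- a :* u := b :* u) refl (ι s) (ι (m ∸ s)) unit ⟩
    ι (m ∸ s) ℚ.* unit                                ∎
    where
    open ≡-Reasoning
    open +-*-Solver
    m≡s+[m-s] : s + (m ∸ s) ≡ m
    m≡s+[m-s] = ℕP.m+[n∸m]≡n (ℕP.≤-trans (ℕP.m≤m+n s s) 2s≤m)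

  weightZ-nonNeg : ∀ {k} (x : Vec (Fin m) k) → 0ℚ ℚ.≤ weightZ m x
  weightZ-nonNeg [] = ι-nonNeg 1
  weightZ-nonNeg (a ∷ x) = *-nonNeg unit-nonNeg (weightZ-nonNeg x)

  weightB-nonNeg : ∀ {k} (y : Vec Bool k) → 0ℚ ℚ.≤ weightB m s y
  weightB-nonNeg [] = ι-nonNeg 1
  weightB-nonNeg (true ∷ y) = *-nonNeg (subst (0ℚ ℚ.≤_) (sym (fraction s)) (*-nonNeg (ι-nonNeg s) unit-nonNeg))
    (weightB-nonNeg y)
  weightB-nonNeg (false ∷ y) = *-nonNeg (subst (0ℚ ℚ.≤_) (sym q-fraction) (*-nonNeg (ι-nonNeg (m ∸ s)) unit-nonNeg))
    (weightB-nonNeg y)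

  μ-F : μ s m (suc n) ℓ F ≡ ΣL xs (λ x → ΣL ys (λ y → ι (size (x , y)) ℚ.* ((unit ℚ.* weightZ m x) ℚ.* weightB m s y)))
  μ-F = begin
    μ s m (suc n) ℓ F
      ≡⟨ sumℚ-concatMap (allFinVecs m (suc n)) (λ v → map (term v) ys) ⟩
    ΣL (allFinVecs m (suc n)) (λ v → ΣL ys (term v))
      ≡⟨ ΣL-concatMap (allFin m) (λ a → map (a ∷_) xs) (λ v → ΣL ys (term v)) ⟩
    ΣL (allFin m) (λ a → ΣL (map (a ∷_) xs) (λ v → ΣL ys (term v)))
      ≡⟨ ΣL-cong (allFin m) (λ a → ΣL-map xs (a ∷_) (λ v → ΣL ys (term v))) ⟩
    ΣL (allFin m) (λ a → ΣL xs (λ x → ΣL ys (term (a ∷ x))))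
      ≡⟨ ΣL-swap (allFin m) xs (λ a x → ΣL ys (term (a ∷ x))) ⟩
    ΣL xs (λ x → ΣL (allFin m) (λ a → ΣL ys (term (a ∷ x))))
      ≡⟨ ΣL-cong xs (λ x → ΣL-swap (allFin m) ys (λ a y → term (a ∷ x) y)) ⟩
    ΣL xs (λ x → ΣL ys (λ y → ΣL (allFin m) (λ a → term (a ∷ x) y)))
      ≡⟨ ΣL-cong xs (λ x → ΣL-cong ys (λ y → ΣL-indicator (allFin m) (fibre (x , y)) _)) ⟩
    ΣL xs (λ x → ΣL ys (λ y → ι (size (x , y)) ℚ.* ((unit ℚ.* weightZ m x) ℚ.* weightB m s y))) ∎
    where
    open ≡-Reasoning
    term : Vec (Fin m) (suc n) → Vec Bool ℓ → ℚ
    term v y = if F v y then weightZ m v ℚ.* weightB m s y else 0ℚ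

  gain : ℕ → Vec (Fin m) n → Vec Bool ℓ → ℚ
  gain θ x y = (if H θ x (true ∷ y) then weightZ m x ℚ.* (p ℚ.* weightB m s y) else 0ℚ)
         ℚ.+ (if H θ x (false ∷ y) then weightZ m x ℚ.* (q ℚ.* weightB m s y) else 0ℚ)

  μ-H : ∀ θ → μ s m n (suc ℓ) (H θ) ≡ ΣL xs (λ x → ΣL ys (gain θ x))
  μ-H θ = trans (sumℚ-concatMap xs _) (ΣL-cong xs (λ x → begin
    ΣL (map (true ∷_) ys ++ map (false ∷_) ys) (term x)
      ≡⟨ ΣL-++ (map (true ∷_) ys) (map (false ∷_) ys) (term x) ⟩
    ΣL (map (true ∷_) ys) (term x) ℚ.+ ΣL (map (false ∷_) ys) (term x)
      ≡⟨ cong₂ ℚ._+_ (ΣL-map ys (true ∷_) (term x)) (ΣL-map ys (false ∷_) (term x)) ⟩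
    ΣL ys (λ y → term x (true ∷ y)) ℚ.+ ΣL ys (λ y → term x (false ∷ y))
      ≡⟨ sym (ΣL-+ ys (λ y → term x (true ∷ y)) (λ y → term x (false ∷ y))) ⟩
    ΣL ys (gain θ x) ∎))
    where
    open ≡-Reasoning
    term : Vec (Fin m) n → Vec Bool (suc ℓ) → ℚ
    term x y = if H θ x y then weightZ m x ℚ.* weightB m s y else 0ℚ

  one-at zero-at : Vec (Fin m) n → Vec Bool ℓ → ℕ → Bool
  one-at x y u = H (s + u) x (true ∷ y)
  zero-at x y u = H (s + u) x (false ∷ y)

  mass : Vec (Fin m) n → Vec Bool ℓ → ℚ
  mass x y = (weightZ m x ℚ.* weightB m s y) ℚ.* unit

  mass-nonNeg : ∀ x y → 0ℚ ℚ.≤ mass x y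
  mass-nonNeg x y = *-nonNeg (*-nonNeg (weightZ-nonNeg x) (weightB-nonNeg y)) unit-nonNeg

  total-gain : ∀ x y → ΣL (downFrom s) (λ u → gain (s + u) x y)
    ≡ mass x y ℚ.* ι (count (one-at x y) (downFrom s) * s + count (zero-at x y) (downFrom s) * (m ∸ s))
  total-gain x y = begin
    ΣL (downFrom s) (λ u → gain (s + u) x y)
      ≡⟨ ΣL-+ (downFrom s) _ _ ⟩
    ΣL (downFrom s) (λ u → if one-at x y u then wZ ℚ.* (p ℚ.* wB) else 0ℚ) ℚ.+
    ΣL (downFrom s) (λ u → if zero-at x y u then wZ ℚ.* (q ℚ.* wB) else 0ℚ)
      ≡⟨ cong₂ ℚ._+_ (ΣL-indicator (downFrom s) (one-at x y) _) (ΣL-indicator (downFrom s) (zero-at x y) _) ⟩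
    ι c₁ ℚ.* (wZ ℚ.* (p ℚ.* wB)) ℚ.+ ι c₀ ℚ.* (wZ ℚ.* (q ℚ.* wB))
      ≡⟨ cong₂ (λ a b → ι c₁ ℚ.* (wZ ℚ.* (a ℚ.* wB)) ℚ.+ ι c₀ ℚ.* (wZ ℚ.* (b ℚ.* wB))) (fraction s) q-fraction ⟩
    ι c₁ ℚ.* (wZ ℚ.* ((ι s ℚ.* unit) ℚ.* wB)) ℚ.+ ι c₀ ℚ.* (wZ ℚ.* ((ι (m ∸ s) ℚ.* unit) ℚ.* wB))
      ≡⟨ solve 7 (λ C₁ C₀ w z u S D → C₁ :* (w :* ((S :* u) :* z)) :+ C₀ :* (w :* ((D :* u) :* z))
                                        := ((w :* z) :* u) :* (C₁ :* S :+ C₀ :* D))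
               refl (ι c₁) (ι c₀) wZ wB unit (ι s) (ι (m ∸ s)) ⟩
    mass x y ℚ.* (ι c₁ ℚ.* ι s ℚ.+ ι c₀ ℚ.* ι (m ∸ s))
      ≡⟨ cong (mass x y ℚ.*_) (sym (trans (ι-+ (c₁ * s) (c₀ * (m ∸ s))) (cong₂ ℚ._+_ (ι-* c₁ s) (ι-* c₀ (m ∸ s))))) ⟩
    mass x y ℚ.* ι (c₁ * s + c₀ * (m ∸ s)) ∎
    where
    open ≡-Reasoning
    open +-*-Solver
    wZ = weightZ m x
    wB = weightB m s y
    c₁ = count (one-at x y) (downFrom s)
    c₀ = count (zero-at x y) (downFrom s)

  -- For a single point, s times its contribution to μ(F) is at most its total
  -- gain over the s thresholds: this is threshold-inequality scaled by the mass.
  point-estimate : ∀ x y → ι s ℚ.* (ι (size (x , y)) ℚ.* ((unit ℚ.* weightZ m x) ℚ.* weightB m s y))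
                           ℚ.≤ ΣL (downFrom s) (λ u → gain (s + u) x y)
  point-estimate x y = subst₂ ℚ._≤_ (sym scaled-size) (sym (total-gain x y))
    (ℚP.*-monoˡ-≤-nonNeg (mass x y) {{ℚ.nonNegative (mass-nonNeg x y)}} (ι-mono counted))
    where
    open +-*-Solver
    k = size (x , y)
    survives : 1 ≤ k → ∀ u → u < s → s ≤ k + u → one-at x y u ≡ true
    survives pos u _ s≤k+u = H-one-if (s + u) x y pos (begin-strict
      s + s               ≤⟨ ℕP.+-monoˡ-≤ s s≤k+u ⟩
      k + u + s           <⟨ ℕP.n<1+n _ ⟩
      suc (k + u + s)     ≡⟨ cong suc (trans (ℕP.+-assoc k u s) (cong (ℕ._+_ k) (ℕP.+-comm u s))) ⟩
      suc (k + (s + u))   ≡⟨ sym (ℕP.+-suc k (s + u)) ⟩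
      k + suc (s + u)     ∎)
      where open ℕP.≤-Reasoning
    counted : s * k ≤ count (one-at x y) (downFrom s) * s + count (zero-at x y) (downFrom s) * (m ∸ s)
    counted = threshold-inequality s k m (one-at x y) (zero-at x y) (size≤m (x , y)) 2s≤m survives
      (λ u → H-zero-if (s + u) x y)
    scaled-size : ι s ℚ.* (ι k ℚ.* ((unit ℚ.* weightZ m x) ℚ.* weightB m s y)) ≡ mass x y ℚ.* ι (s * k)
    scaled-size = trans (solve 5 (λ S K u w z → S :* (K :* ((u :* w) :* z)) := ((w :* z) :* u) :* (S :* K))
                               refl (ι s) (ι k) unit (weightZ m x) (weightB m s y))
                        (cong (mass x y ℚ.*_) (sym (ι-* s k)))

  averaged-measure : ι s ℚ.* μ s m (suc n) ℓ F ℚ.≤ ΣL (downFrom s) (λ u → μ s m n (suc ℓ) (H (s + u)))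
  averaged-measure = subst₂ ℚ._≤_ (sym scaled-μ-F) (sym summed-μ-H)
    (ΣL-mono xs (λ x → ΣL-mono ys (λ y → point-estimate x y)))
    where
    scaled-μ-F : ι s ℚ.* μ s m (suc n) ℓ F
               ≡ ΣL xs (λ x → ΣL ys (λ y → ι s ℚ.* (ι (size (x , y)) ℚ.* ((unit ℚ.* weightZ m x) ℚ.* weightB m s y))))
    scaled-μ-F = trans (cong (ι s ℚ.*_) μ-F)
      (trans (sym (ΣL-scale xs (ι s) _)) (ΣL-cong xs (λ x → sym (ΣL-scale ys (ι s) _))))
    summed-μ-H : ΣL (downFrom s) (λ u → μ s m n (suc ℓ) (H (s + u)))
               ≡ ΣL xs (λ x → ΣL ys (λ y → ΣL (downFrom s) (λ u → gain (s + u) x y)))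
    summed-μ-H = trans (ΣL-cong (downFrom s) (λ u → μ-H (s + u)))
      (trans (ΣL-swap (downFrom s) xs (λ u x → ΣL ys (gain (s + u) x)))
             (ΣL-cong xs (λ x → ΣL-swap (downFrom s) ys (λ u y → gain (s + u) x y))))

lemma5p6 : (m s n ℓ t : ℕ) .{{_ : NonZero m}} → 2 ≤ m → 1 ≤ s → 2 * s ≤ m →
    (F : Family m (suc n) ℓ) → TAgreeing m s t F →
    Σ (Family m n (suc ℓ)) λ H → TAgreeing m s t H ×
    μ s m (suc n) ℓ F ≤ℚ μ s m n (suc ℓ) H
lemma5p6 (suc M) s@(suc s′) n ℓ t _ _ 2s≤m F F-agreeing =
  H (s + u) , H-agreeing (s + u) (ℕP.m≤m+n s u) , μF≤μH
  where
  2s≤m′ : s + s ≤ suc M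
  2s≤m′ = subst (_≤ suc M) (cong (ℕ._+_ s) (ℕP.+-identityʳ s)) 2s≤m
  open Averaging M s n ℓ t 2s≤m′ F F-agreeing
  best-threshold : ∃ λ u → μ s m (suc n) ℓ F ℚ.≤ μ s m n (suc ℓ) (H (s + u))
  best-threshold = average s′ (λ u → μ s m n (suc ℓ) (H (s + u))) (μ s m (suc n) ℓ F) averaged-measure
  u = proj₁ best-threshold
  μF≤μH = proj₂ best-threshold
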